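{- Let $n\ge 2$ be an integer. Let $\mathcal{T}_n$ be the set of sequences $(0,S_1,\dots,S_{2n})\in\mathbb{Z}^{2n+1}$ with $S_0=0$, $|S_i-S_{i-1}|=1$ for $1\le i\le 2n$, $S_{2n}=0$ and $S_i\ge 0$ for all $1\le i\le 2n-1$. For such a sequence let $N=|\{i\in\{1,\dots,n-1\}: S_{2i}=0\}|$, and let $$\mathcal{C}_n=\{\text{sequences in }\mathcal{T}_n\text{ with } N=0\},\qquad \mathcal{D}_n=\{\text{sequences in }\mathcal{T}_n\text{ with } N=1\}.$$ Then the map $\Phi_2:\mathcal{C}_n\to\mathcal{D}_n$ defined below is a well-defined bijection between $\mathcal{C}_n$ and $\mathcal{D}_n$. Definition of $\Phi_2$: for $(0,S_1,\dots,S_{2n})\in\mathcal{C}_n$, let $\tau=\min\{k>1: S_k=1\}$ (one has $2<\tau<2n$). For $\ell=1,\dots,2n$ set $$T_\ell=\begin{cases}S_\ell-2 & \text{if } 1<\ell<\tau \text{ and } S_{\ell+1}=S_\ell-1,\\ S_\ell & \text{otherwise},\end{cases}$$ and $\Phi_2((0,S_1,\dots,S_{2n}))=(0,T_1,\dots,T_{2n})$.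
   Context: Sequences $(0,S_1,\dots,S_{2n})$ with $S_0=0$ and $|S_i-S_{i-1}|=1$ are the $2n$-step simple random walk paths on $\mathbb{Z}$ starting at the origin; $\mathcal{C}_n$ consists of such paths returning to $0$ at time $2n$ and strictly positive at times $1,\dots,2n-1$, and $\mathcal{D}_n$ of such paths returning to $0$ at time $2n$, nonnegative in between, and hitting $0$ at exactly one time in $\{1,\dots,2n-1\}$. -}

module Defs where

open import Data.Nat using (ℕ; zero; suc; _≤_; _∸_; _*_; _<?_)
open import Data.Integer using (ℤ; +_; 0ℤ; 1ℤ; _-_; ∣_∣) renaming (_≤_ to _≤ℤ_)
import Data.Integer as ℤ
open import Data.Vec using (Vec; []; _∷_; tabulate)
open import Data.Fin using (toℕ)
open import Data.List using (List; length; filter; map; upTo)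
open import Data.Bool using (Bool; true; false; if_then_else_; _∧_)
open import Data.Product using (_×_)
open import Relation.Nullary using (does)
open import Relation.Binary.PropositionalEquality using (_≡_)

-- Total lookup: S ‼ i is the i-th entry (0-based) of S, and 0 if i is out of range.
-- For the sequences (S_0,…,S_{2n}) below we only ever use it in range, except in
-- the definition of Φ₂ where the out-of-range case is never reached on 𝒞ₙ.
_‼_ : ∀ {m} → Vec ℤ m → ℕ → ℤ
[]      ‼ _       = 0ℤ
(x ∷ _) ‼ zero    = x
(_ ∷ v) ‼ (suc i) = v ‼ i

Seq : ℕ → Set
Seq n = Vec ℤ (suc (2 * n))

InT : (n : ℕ) → Seq n → Set
InT n S =
  (S ‼ 0 ≡ 0ℤ)
  × (∀ i → 1 ≤ i → i ≤ 2 * n → ∣ S ‼ i - S ‼ (i ∸ 1) ∣ ≡ 1)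
  × (S ‼ (2 * n) ≡ 0ℤ)
  × (∀ i → 1 ≤ i → i ≤ 2 * n ∸ 1 → 0ℤ ≤ℤ S ‼ i)

countN : (n : ℕ) → Seq n → ℕ
countN n S = length (filter (λ i → S ‼ (2 * i) ℤ.≟ 0ℤ) (map suc (upTo (n ∸ 1))))

𝒞 : (n : ℕ) → Seq n → Set
𝒞 n S = InT n S × countN n S ≡ 0

𝒟 : (n : ℕ) → Seq n → Set
𝒟 n S = InT n S × countN n S ≡ 1

findFrom : ∀ {m} → Vec ℤ m → ℕ → ℕ → ℕ
findFrom S k zero    = k
findFrom S k (suc f) = if does (S ‼ k ℤ.≟ 1ℤ) then k else findFrom S (suc k) f

-- τ = min { k > 1 : S_k = 1 }  (searching k = 2, …, 2n; on 𝒞ₙ such k exists)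
τ : (n : ℕ) → Seq n → ℕ
τ n S = findFrom S 2 (2 * n ∸ 1)

Tval : (n : ℕ) → Seq n → ℕ → ℤ
Tval n S zero = 0ℤ
Tval n S ℓ@(suc _) =
  if does (1 <? ℓ) ∧ does (ℓ <? τ n S) ∧ does (S ‼ suc ℓ ℤ.≟ S ‼ ℓ - 1ℤ)
  then S ‼ ℓ - + 2
  else S ‼ ℓ

Φ₂ : (n : ℕ) → Seq n → Seq n
Φ₂ n S = tabulate (λ ℓ → Tval n S (toℕ ℓ))

module Submission where

-- Let s be the height profile of a path S ∈ 𝒞ₙ and τ its first return to level 1
-- after time 1.  Because S stays ≥ 2 strictly between times 2 and τ, the rule
-- defining Φ₂ amounts to T_ℓ = S_{ℓ+1} − 1 for ℓ < τ and T_ℓ = S_ℓ for ℓ ≥ τ: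
-- the first excursion is shifted one step to the left and lowered by one
-- ('lower τ s').  The inverse operation 'raise' shifts right and raises by one.

open import Defs
open import Data.Nat using (ℕ; zero; suc; pred; _+_; _*_; _∸_; _≤_; _<_; z≤n; s≤s; z<s; _<?_; _≤?_)
open import Data.Nat.Properties
open import Data.Integer using (ℤ; +_; 0ℤ; 1ℤ; _-_; ∣_∣; _⊖_; +≤+) renaming (_≤_ to _≤ℤ_)
import Data.Integer as ℤ
import Data.Integer.Properties as ℤ
open import Data.Vec using (Vec; []; _∷_; tabulate)
open import Data.Fin using (toℕ)
open import Data.List using (List; []; _∷_; length; filter; applyUpTo)
open import Data.List.Properties using (filter-accept; filter-reject; map-applyUpTo)
open import Data.Bool using (if_then_else_)
open import Data.Product using (_×_; Σ; ∃; _,_; proj₁; proj₂)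
open import Data.Sum using (_⊎_; inj₁; inj₂)
open import Data.Empty using (⊥; ⊥-elim)
open import Function using (id)
open import Relation.Nullary using (¬_; Dec; yes; no; does)
open import Relation.Nullary.Decidable using (dec-true; dec-false)
open import Relation.Binary.PropositionalEquality
open import Relation.Binary.Definitions using (tri<; tri≈; tri>)
open ≡-Reasoning

‼-beyond : ∀ {m} (V : Vec ℤ m) k → m ≤ k → V ‼ k ≡ 0ℤ
‼-beyond []      k       _         = refl
‼-beyond (_ ∷ V) (suc k) (s≤s m≤k) = ‼-beyond V k m≤k

‼-tabulate : ∀ {m} (g : ℕ → ℤ) k → k < m → tabulate {n = m} (λ i → g (toℕ i)) ‼ k ≡ g k
‼-tabulate {suc m} g zero    _         = refl
‼-tabulate {suc m} g (suc k) (s≤s k<m) = ‼-tabulate (λ i → g (suc i)) k k<m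

‼-ext : ∀ {m} (U V : Vec ℤ m) → (∀ k → U ‼ k ≡ V ‼ k) → U ≡ V
‼-ext []      []      _  = refl
‼-ext (x ∷ U) (y ∷ V) eq = cong₂ _∷_ (eq 0) (‼-ext U V (λ k → eq (suc k)))

Adj : ℕ → ℕ → Set
Adj a b = a ≡ suc b ⊎ b ≡ suc a

Adj-suc : ∀ {a b} → Adj a b → Adj (suc a) (suc b)
Adj-suc (inj₁ e) = inj₁ (cong suc e)
Adj-suc (inj₂ e) = inj₂ (cong suc e)

Adj-pred : ∀ {a b} → Adj (suc a) (suc b) → Adj a b
Adj-pred (inj₁ e) = inj₁ (suc-injective e)
Adj-pred (inj₂ e) = inj₂ (suc-injective e)

Adj-pred⁺ : ∀ {a b} → 1 ≤ a → 1 ≤ b → Adj a b → Adj (pred a) (pred b)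
Adj-pred⁺ (s≤s _) (s≤s _) = Adj-pred

∣⊖∣≡1⇒Adj : ∀ a b → ∣ a ⊖ b ∣ ≡ 1 → Adj a b
∣⊖∣≡1⇒Adj zero    zero    ()
∣⊖∣≡1⇒Adj zero    (suc b) e = inj₂ e
∣⊖∣≡1⇒Adj (suc a) zero    e = inj₁ e
∣⊖∣≡1⇒Adj (suc a) (suc b) e =
  Adj-suc (∣⊖∣≡1⇒Adj a b (trans (cong ∣_∣ (sym (ℤ.[1+m]⊖[1+n]≡m⊖n a b))) e))

Adj⇒∣⊖∣≡1 : ∀ a b → Adj a b → ∣ a ⊖ b ∣ ≡ 1
Adj⇒∣⊖∣≡1 zero          (suc zero)    _         = refl
Adj⇒∣⊖∣≡1 (suc zero)    zero          _         = refl
Adj⇒∣⊖∣≡1 (suc a)       (suc b)       adj       =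
  trans (cong ∣_∣ (ℤ.[1+m]⊖[1+n]≡m⊖n a b)) (Adj⇒∣⊖∣≡1 a b (Adj-pred adj))
Adj⇒∣⊖∣≡1 zero          zero          (inj₁ ())
Adj⇒∣⊖∣≡1 zero          zero          (inj₂ ())
Adj⇒∣⊖∣≡1 zero          (suc (suc _)) (inj₁ ())
Adj⇒∣⊖∣≡1 zero          (suc (suc _)) (inj₂ ())
Adj⇒∣⊖∣≡1 (suc (suc _)) zero          (inj₁ ())
Adj⇒∣⊖∣≡1 (suc (suc _)) zero          (inj₂ ())

unit-step⇒Adj : ∀ a b → ∣ + a - + b ∣ ≡ 1 → Adj a b
unit-step⇒Adj a b e = ∣⊖∣≡1⇒Adj a b (trans (cong ∣_∣ (sym (ℤ.[+m]-[+n]≡m⊖n a b))) e)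

Adj⇒unit-step : ∀ {a b} → Adj a b → ∣ + a - + b ∣ ≡ 1
Adj⇒unit-step {a} {b} adj = trans (cong ∣_∣ (ℤ.[+m]-[+n]≡m⊖n a b)) (Adj⇒∣⊖∣≡1 a b adj)

record Path (L : ℕ) (h : ℕ → ℕ) : Set where
  field
    start : h 0 ≡ 0
    end   : ∀ k → L ≤ k → h k ≡ 0
    step  : ∀ k → k < L → Adj (h (suc k)) (h k)
open Path

after-zero : ∀ {L h k} → Path L h → k < L → h k ≡ 0 → h (suc k) ≡ 1
after-zero {k = k} p k<L z with step p k k<L
... | inj₁ e = trans e (cong suc z)
... | inj₂ e with () ← trans (sym z) e

before-zero : ∀ {L h k} → Path L h → k < L → h (suc k) ≡ 0 → h k ≡ 1
before-zero {k = k} p k<L z with step p k k<L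
... | inj₁ e with () ← trans (sym z) e
... | inj₂ e = trans e (cong suc z)

Even : ℕ → Set
Even m = ∃ λ i → m ≡ 2 * i

path-parity : ∀ {L h} → Path L h → ∀ k → k ≤ L → Even (k + h k)
path-parity p zero _ = 0 , start p
path-parity {h = h} p (suc k) k<L with path-parity p k (<⇒≤ k<L) | step p k k<L
... | i , e | inj₁ up = suc i , (begin
  suc k + h (suc k)    ≡⟨ cong (λ x → suc k + x) up ⟩
  suc k + suc (h k)    ≡⟨ cong suc (+-suc k (h k)) ⟩
  suc (suc (k + h k))  ≡⟨ cong (λ x → suc (suc x)) e ⟩
  suc (suc (2 * i))    ≡⟨ *-suc 2 i ⟨
  2 * suc i            ∎)
... | i , e | inj₂ down = i , (begin
  suc k + h (suc k)    ≡⟨ +-suc k (h (suc k)) ⟨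
  k + suc (h (suc k))  ≡⟨ cong (λ x → k + x) down ⟨
  k + h k              ≡⟨ e ⟩
  2 * i                ∎)

zero-at-even : ∀ {L h} → Path L h → ∀ k → k ≤ L → h k ≡ 0 → Even k
zero-at-even p k k≤L z with path-parity p k k≤L
... | i , e = i , trans (sym (+-identityʳ k)) (trans (cong (λ x → k + x) (sym z)) e)

one-at-odd : ∀ {L h} → Path L h → ∀ k → k ≤ L → h k ≡ 1 → ∃ λ j → k ≡ suc (2 * j)
one-at-odd p k k≤L o with path-parity p k k≤L
... | i , e = half {i} (trans (+-comm 1 k) (trans (cong (λ x → k + x) (sym o)) e))
  where
  half : ∀ {i} → suc k ≡ 2 * i → ∃ λ j → k ≡ suc (2 * j)
  half {suc j} e′ = j , suc-injective (trans e′ (*-suc 2 j))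

height : ∀ {m} → Vec ℤ m → ℕ → ℕ
height V k = ∣ V ‼ k ∣

record HasHeights {m} (V : Vec ℤ m) (h : ℕ → ℕ) : Set where
  constructor hasHeights
  field entry : ∀ k → V ‼ k ≡ + h k
open HasHeights

module _ {m} {V : Vec ℤ m} {h : ℕ → ℕ} (hV : HasHeights V h) where

  value⇒height : ∀ {k a} → V ‼ k ≡ + a → h k ≡ a
  value⇒height {k} e = ℤ.+-injective (trans (sym (entry hV k)) e)

  height⇒value : ∀ {k a} → h k ≡ a → V ‼ k ≡ + a
  height⇒value {k} e = trans (entry hV k) (cong +_ e)

InT-nonneg : ∀ {n S} → InT n S → ∀ k → 0ℤ ≤ℤ S ‼ k
InT-nonneg (S₀ , _ , _ , _) zero = ℤ.≤-reflexive (sym S₀)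
InT-nonneg {n} {S} (_ , _ , S₂ₙ , nonneg) k@(suc _) with <-cmp k (2 * n)
... | tri< k<2n _ _ = nonneg k (s≤s z≤n) (∸-monoˡ-≤ 1 k<2n)
... | tri≈ _ k≡2n _ = ℤ.≤-reflexive (sym (trans (cong (S ‼_) k≡2n) S₂ₙ))
... | tri> _ _ k>2n = ℤ.≤-reflexive (sym (‼-beyond S k k>2n))

InT⇒HasHeights : ∀ {n S} → InT n S → HasHeights S (height S)
InT⇒HasHeights {n} {S} t = hasHeights (λ k → sym (ℤ.0≤i⇒+∣i∣≡i (InT-nonneg {n} {S} t k)))

InT⇒Path : ∀ {n S} → InT n S → Path (2 * n) (height S)
InT⇒Path {n} {S} t@(S₀ , steps , S₂ₙ , _) =
  record { start = cong ∣_∣ S₀ ; end = end′ ; step = step′ }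
  where
  hS : HasHeights S (height S)
  hS = InT⇒HasHeights {n} {S} t
  end′ : ∀ k → 2 * n ≤ k → height S k ≡ 0
  end′ k 2n≤k with m≤n⇒m<n∨m≡n 2n≤k
  ... | inj₁ 2n<k = cong ∣_∣ (‼-beyond S k 2n<k)
  ... | inj₂ 2n≡k = trans (cong (height S) (sym 2n≡k)) (cong ∣_∣ S₂ₙ)
  step′ : ∀ k → k < 2 * n → Adj (height S (suc k)) (height S k)
  step′ k k<2n = unit-step⇒Adj _ _ (subst₂ (λ x y → ∣ x - y ∣ ≡ 1)
    (entry hS (suc k)) (entry hS k) (steps (suc k) (s≤s z≤n) k<2n))

HasHeights⇒InT : ∀ {n} {V : Seq n} {h} → HasHeights V h → Path (2 * n) h → InT n V
HasHeights⇒InT {n} {V} hV p =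
    height⇒value hV (start p)
  , steps
  , height⇒value hV (end p (2 * n) ≤-refl)
  , (λ i _ _ → subst (0ℤ ≤ℤ_) (sym (entry hV i)) (+≤+ z≤n))
  where
  steps : ∀ i → 1 ≤ i → i ≤ 2 * n → ∣ V ‼ i - V ‼ (i ∸ 1) ∣ ≡ 1
  steps (suc k) _ k<2n =
    subst₂ (λ x y → ∣ x - y ∣ ≡ 1) (sym (entry hV (suc k))) (sym (entry hV k))
           (Adj⇒unit-step (step p k k<2n))

fromHeights : (n : ℕ) → (ℕ → ℕ) → Seq n
fromHeights n h = tabulate (λ i → + h (toℕ i))

fromHeights-heights : ∀ {n h} → Path (2 * n) h → HasHeights (fromHeights n h) h
fromHeights-heights {n} {h} p = hasHeights entry′
  where
  entry′ : ∀ k → fromHeights n h ‼ k ≡ + h k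
  entry′ k with k <? suc (2 * n)
  ... | yes k<len = ‼-tabulate (λ i → + h i) k k<len
  ... | no  k≮len = trans (‼-beyond (fromHeights n h) k (≮⇒≥ k≮len))
                          (cong +_ (sym (end p k (<⇒≤ (≮⇒≥ k≮len)))))

interval : ℕ → ℕ → List ℕ
interval k zero    = []
interval k (suc m) = k ∷ interval (suc k) m

applyUpTo-interval : ∀ (f : ℕ → ℕ) k m → (∀ i → f i ≡ k + i) → applyUpTo f m ≡ interval k m
applyUpTo-interval f k zero    _  = refl
applyUpTo-interval f k (suc m) eq = cong₂ _∷_ (trans (eq 0) (+-identityʳ k))
  (applyUpTo-interval (λ i → f (suc i)) (suc k) m (λ i → trans (eq (suc i)) (+-suc k i)))

module IntervalCount {P : ℕ → Set} (P? : ∀ i → Dec (P i)) where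

  count : ℕ → ℕ → ℕ
  count k m = length (filter P? (interval k m))

  OnlyWitness : ℕ → ℕ → ℕ → Set
  OnlyWitness k m j = k ≤ j × j < k + m × P j × (∀ i → k ≤ i → i < k + m → P i → i ≡ j)

  private
    peel : ∀ {i} k m → i < k + suc m → i < suc k + m
    peel {i} k m = subst (i <_) (+-suc k m)

    unpeel : ∀ {i} k m → i < suc k + m → i < k + suc m
    unpeel {i} k m = subst (i <_) (sym (+-suc k m))

    first∈ : ∀ k m → k < k + suc m
    first∈ k m = m<m+n k z<s

    empty : ∀ {k i} → k ≤ i → i < k + 0 → ⊥
    empty {k} k≤i i<k = <⇒≱ i<k (subst (_≤ _) (sym (+-identityʳ k)) k≤i)

  count≡0⇒none : ∀ k m → count k m ≡ 0 → ∀ i → k ≤ i → i < k + m → ¬ P i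
  count≡0⇒none k zero    _ i k≤i i<k _ = empty k≤i i<k
  count≡0⇒none k (suc m) c i k≤i i<k Pi with P? k
  ... | yes _ with () ← c
  ... | no ¬Pk with m≤n⇒m<n∨m≡n k≤i
  ...   | inj₂ refl = ¬Pk Pi
  ...   | inj₁ k<i  = count≡0⇒none (suc k) m c i k<i (peel k m i<k) Pi

  none⇒count≡0 : ∀ k m → (∀ i → k ≤ i → i < k + m → ¬ P i) → count k m ≡ 0
  none⇒count≡0 k zero    _    = refl
  none⇒count≡0 k (suc m) none =
    trans (cong length (filter-reject P? (none k ≤-refl (first∈ k m))))
          (none⇒count≡0 (suc k) m (λ i k<i i<k → none i (<⇒≤ k<i) (unpeel k m i<k)))

  count≡1⇒unique : ∀ k m → count k m ≡ 1 → ∃ (OnlyWitness k m)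
  count≡1⇒unique k zero ()
  count≡1⇒unique k (suc m) c with P? k
  ... | yes Pk = k , ≤-refl , first∈ k m , Pk , only
    where
    rest : count (suc k) m ≡ 0
    rest = suc-injective c
    only : ∀ i → k ≤ i → i < k + suc m → P i → i ≡ k
    only i k≤i i<k Pi with m≤n⇒m<n∨m≡n k≤i
    ... | inj₂ refl = refl
    ... | inj₁ k<i  = ⊥-elim (count≡0⇒none (suc k) m rest i k<i (peel k m i<k) Pi)
  ... | no ¬Pk with count≡1⇒unique (suc k) m c
  ...   | j , k<j , j<k , Pj , only′ = j , <⇒≤ k<j , unpeel k m j<k , Pj , only
    where
    only : ∀ i → k ≤ i → i < k + suc m → P i → i ≡ j
    only i k≤i i<k Pi with m≤n⇒m<n∨m≡n k≤i
    ... | inj₂ refl = ⊥-elim (¬Pk Pi)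
    ... | inj₁ k<i  = only′ i k<i (peel k m i<k) Pi

  unique⇒count≡1 : ∀ k m j → OnlyWitness k m j → count k m ≡ 1
  unique⇒count≡1 k zero    j (k≤j , j<k , _) = ⊥-elim (empty k≤j j<k)
  unique⇒count≡1 k (suc m) j (k≤j , j<k , Pj , only) with m≤n⇒m<n∨m≡n k≤j
  ... | inj₂ refl = trans (cong length (filter-accept P? Pj)) (cong suc (none⇒count≡0 (suc k) m
        (λ i k<i i<k Pi → <-irrefl (sym (only i (<⇒≤ k<i) (unpeel k m i<k) Pi)) k<i)))
  ... | inj₁ k<j = trans (cong length (filter-reject P? (λ Pk → <-irrefl (only k ≤-refl (first∈ k m) Pk) k<j)))
        (unique⇒count≡1 (suc k) m j
          (k<j , peel k m j<k , Pj , λ i k<i i<k → only i (<⇒≤ k<i) (unpeel k m i<k)))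

evenZero? : ∀ {m} (S : Vec ℤ m) i → Dec (S ‼ (2 * i) ≡ 0ℤ)
evenZero? S i = S ‼ (2 * i) ℤ.≟ 0ℤ

countN-interval : ∀ {n} (S : Seq (suc n)) → countN (suc n) S ≡ IntervalCount.count (evenZero? S) 1 n
countN-interval {n} S = cong (λ xs → length (filter (evenZero? S) xs))
  (trans (map-applyUpTo id suc n) (applyUpTo-interval suc 1 n (λ _ → refl)))

NoEvenZero : ℕ → (ℕ → ℕ) → Set
NoEvenZero n h = ∀ i → 1 ≤ i → i < n → h (2 * i) ≢ 0

UniqueEvenZero : ℕ → (ℕ → ℕ) → ℕ → Set
UniqueEvenZero n h j = 1 ≤ j × j < n × h (2 * j) ≡ 0 × (∀ i → 1 ≤ i → i < n → h (2 * i) ≡ 0 → i ≡ j)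

countN≡0⇒ : ∀ {n} {V : Seq n} {h} → HasHeights V h → countN n V ≡ 0 → NoEvenZero n h
countN≡0⇒ {suc n} {V} hV c i 1≤i i<n z = IntervalCount.count≡0⇒none (evenZero? V) 1 n
  (trans (sym (countN-interval V)) c) i 1≤i i<n (height⇒value hV z)
countN≡0⇒ {zero} _ _ _ _ ()

⇒countN≡0 : ∀ {n} {V : Seq n} {h} → HasHeights V h → NoEvenZero n h → countN n V ≡ 0
⇒countN≡0 {suc n} {V} hV none = trans (countN-interval V) (IntervalCount.none⇒count≡0 (evenZero? V) 1 n
  (λ i 1≤i i<n e → none i 1≤i i<n (value⇒height hV e)))
⇒countN≡0 {zero} _ _ = refl

countN≡1⇒ : ∀ {n} {V : Seq n} {h} → HasHeights V h → countN n V ≡ 1 → ∃ (UniqueEvenZero n h)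
countN≡1⇒ {suc n} {V} hV c
  with IntervalCount.count≡1⇒unique (evenZero? V) 1 n (trans (sym (countN-interval V)) c)
... | j , 1≤j , j<n , z , only =
  j , 1≤j , j<n , value⇒height hV z , λ i 1≤i i<n z′ → only i 1≤i i<n (height⇒value hV z′)
countN≡1⇒ {zero} _ ()

⇒countN≡1 : ∀ {n} {V : Seq n} {h j} → HasHeights V h → UniqueEvenZero n h j → countN n V ≡ 1
⇒countN≡1 {suc n} {V} {j = j} hV (1≤j , j<n , z , only) = trans (countN-interval V)
  (IntervalCount.unique⇒count≡1 (evenZero? V) 1 n j
    (1≤j , j<n , height⇒value hV z , λ i 1≤i i<n e → only i 1≤i i<n (value⇒height hV e)))
⇒countN≡1 {zero} _ (_ , () , _)

record FirstOne {m} (V : Vec ℤ m) (k t : ℕ) : Set where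
  field
    from  : k ≤ t
    hits  : V ‼ t ≡ 1ℤ
    first : ∀ i → k ≤ i → i < t → V ‼ i ≢ 1ℤ
open FirstOne

findFrom-first : ∀ {m} (V : Vec ℤ m) k f j → k ≤ j → j < k + f → V ‼ j ≡ 1ℤ →
  FirstOne V k (findFrom V k f) × findFrom V k f ≤ j
findFrom-first V k zero j k≤j j<k _ = ⊥-elim (<⇒≱ j<k (subst (_≤ j) (sym (+-identityʳ k)) k≤j))
findFrom-first V k (suc f) j k≤j j<k Vj with V ‼ k ℤ.≟ 1ℤ
... | yes Vk = record { from = ≤-refl ; hits = Vk ; first = λ i k≤i i<k → ⊥-elim (<⇒≱ i<k k≤i) } , k≤j
... | no ¬Vk with m≤n⇒m<n∨m≡n k≤j
...   | inj₂ refl = ⊥-elim (¬Vk Vj)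
...   | inj₁ k<j with findFrom-first V (suc k) f j k<j (subst (j <_) (+-suc k f) j<k) Vj
...     | hit , t≤j = record { from = <⇒≤ (from hit) ; hits = hits hit ; first = first′ } , t≤j
  where
  first′ : ∀ i → k ≤ i → i < findFrom V (suc k) f → V ‼ i ≢ 1ℤ
  first′ i k≤i i<t with m≤n⇒m<n∨m≡n k≤i
  ... | inj₂ refl = ¬Vk
  ... | inj₁ k<i  = first hit i k<i i<t

findFrom-exact : ∀ {m} (V : Vec ℤ m) k f j → FirstOne V k j → j < k + f → findFrom V k f ≡ j
findFrom-exact V k f j hit j<k+f with findFrom-first V k f j (from hit) j<k+f (hits hit)
... | hit′ , t≤j with m≤n⇒m<n∨m≡n t≤j
...   | inj₂ t≡j = t≡j
...   | inj₁ t<j = ⊥-elim (first hit _ (from hit′) t<j (hits hit′))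

suc[2n∸1] : ∀ {n} → 1 ≤ n → suc (2 * n ∸ 1) ≡ 2 * n
suc[2n∸1] {suc n} _ = refl

-- On a path of length 2n (n ≥ 2) the height at time 2n-1 is 1, so τ is the first
-- visit to 1 from time 2 on, and τ < 2n.
τ-first-one : ∀ {n} {S : Seq n} {s} → 2 ≤ n → HasHeights S s → Path (2 * n) s →
  FirstOne S 2 (τ n S) × τ n S < 2 * n
τ-first-one {n} {S} {s} 2≤n hS p = proj₁ found , ≤-<-trans (proj₂ found) (≤-reflexive last)
  where
  L′ = 2 * n ∸ 1
  last : suc L′ ≡ 2 * n
  last = suc[2n∸1] (≤-trans (s≤s z≤n) 2≤n)
  s[L′]≡1 : s L′ ≡ 1
  s[L′]≡1 = before-zero p (≤-reflexive last) (trans (cong s last) (end p (2 * n) ≤-refl))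
  3≤L′ : 3 ≤ L′
  3≤L′ = ∸-monoˡ-≤ 1 (*-monoʳ-≤ 2 2≤n)
  found = findFrom-first S 2 L′ L′ (≤-trans (n≤1+n 2) 3≤L′) (s≤s (m≤n+m L′ 1)) (height⇒value hS s[L′]≡1)

record FirstExcursion (L : ℕ) (s : ℕ → ℕ) (r : ℕ) : Set where
  field
    path    : Path L s
    r≥3     : 3 ≤ r
    r<L     : r < L
    returns : s r ≡ 1
    above   : ∀ i → 2 ≤ i → i < r → 2 ≤ s i
open FirstExcursion

two≤ : ∀ {a} → a ≢ 0 → a ≢ 1 → 2 ≤ a
two≤ {zero}        a≢0 _   = ⊥-elim (a≢0 refl)
two≤ {suc zero}    _   a≢1 = ⊥-elim (a≢1 refl)
two≤ {suc (suc _)} _   _   = s≤s (s≤s z≤n)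

module _ {L s r} (E : FirstExcursion L s r) where

  0<r : 0 < r
  0<r = ≤-trans (s≤s z≤n) (r≥3 E)

  1<r : 1 < r
  1<r = ≤-trans (n≤1+n 2) (r≥3 E)

  excursion-1 : s 1 ≡ 1
  excursion-1 = after-zero (path E) (<-trans 0<r (r<L E)) (start (path E))

  excursion-2 : s 2 ≡ 2
  excursion-2 with step (path E) 1 (<-trans 1<r (r<L E))
  ... | inj₁ e = trans e (cong suc excursion-1)
  ... | inj₂ e with () ← subst (2 ≤_) (suc-injective (trans (sym e) excursion-1)) (above E 2 ≤-refl (r≥3 E))

  excursion-positive : ∀ i → 1 ≤ i → i ≤ r → 1 ≤ s i
  excursion-positive i 1≤i i≤r with m≤n⇒m<n∨m≡n 1≤i | m≤n⇒m<n∨m≡n i≤r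
  ... | inj₂ refl | _         = ≤-reflexive (sym excursion-1)
  ... | inj₁ _    | inj₂ refl = ≤-reflexive (sym (returns E))
  ... | inj₁ 1<i  | inj₁ i<r  = ≤-trans (s≤s z≤n) (above E i 1<i i<r)

suc-pred⁺ : ∀ {a} → 1 ≤ a → suc (pred a) ≡ a
suc-pred⁺ (s≤s _) = refl

-- The profile of Φ₂(S) in terms of that of S: before r, look one step ahead and lower by one.
lower : ℕ → (ℕ → ℕ) → ℕ → ℕ
lower r s ℓ = if does (ℓ <? r) then pred (s (suc ℓ)) else s ℓ

lower-before : ∀ {r} s ℓ → ℓ < r → lower r s ℓ ≡ pred (s (suc ℓ))
lower-before {r} s ℓ ℓ<r rewrite dec-true (ℓ <? r) ℓ<r = refl

lower-after : ∀ {r} s ℓ → r ≤ ℓ → lower r s ℓ ≡ s ℓ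
lower-after {r} s ℓ r≤ℓ rewrite dec-false (ℓ <? r) (≤⇒≯ r≤ℓ) = refl

raise : ℕ → (ℕ → ℕ) → ℕ → ℕ
raise r u zero    = 0
raise r u (suc ℓ) = if does (ℓ <? r) then suc (u ℓ) else u (suc ℓ)

raise-before : ∀ {r} u ℓ → ℓ < r → raise r u (suc ℓ) ≡ suc (u ℓ)
raise-before {r} u ℓ ℓ<r rewrite dec-true (ℓ <? r) ℓ<r = refl

raise-after : ∀ {r} u ℓ → r ≤ ℓ → raise r u (suc ℓ) ≡ u (suc ℓ)
raise-after {r} u ℓ r≤ℓ rewrite dec-false (ℓ <? r) (≤⇒≯ r≤ℓ) = refl

lower-path : ∀ {L s r} → FirstExcursion L s r → Path L (lower r s)
lower-path {L} {s} {r} E = record { start = start′ ; end = end′ ; step = step′ }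
  where
  start′ : lower r s 0 ≡ 0
  start′ = trans (lower-before s 0 (0<r E)) (cong pred (excursion-1 E))
  end′ : ∀ k → L ≤ k → lower r s k ≡ 0
  end′ k L≤k = trans (lower-after s k (≤-trans (<⇒≤ (r<L E)) L≤k)) (end (path E) k L≤k)
  step′ : ∀ k → k < L → Adj (lower r s (suc k)) (lower r s k)
  step′ k k<L with <-cmp (suc k) r
  ... | tri< k+1<r _ _ = subst₂ Adj
          (sym (lower-before s (suc k) k+1<r)) (sym (lower-before s k (<-trans (n<1+n k) k+1<r)))
          (Adj-pred⁺ (excursion-positive E (suc (suc k)) (s≤s z≤n) k+1<r)
                     (excursion-positive E (suc k) (s≤s z≤n) (<⇒≤ k+1<r))
                     (step (path E) (suc k) (<-trans k+1<r (r<L E))))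
  ... | tri≈ _ k+1≡r _ = subst₂ Adj
          (sym (trans (lower-after s (suc k) (≤-reflexive (sym k+1≡r))) s[k+1]≡1))
          (sym (trans (lower-before s k (≤-reflexive k+1≡r)) (cong pred s[k+1]≡1))) (inj₁ refl)
    where
    s[k+1]≡1 : s (suc k) ≡ 1
    s[k+1]≡1 = trans (cong s k+1≡r) (returns E)
  ... | tri> _ _ r<k+1 = subst₂ Adj
          (sym (lower-after s (suc k) (<⇒≤ r<k+1))) (sym (lower-after s k (≤-pred r<k+1)))
          (step (path E) k k<L)

raise-from-return : ∀ {L u ρ} → Path L u → ρ < L → u ρ ≡ 0 → ∀ ℓ → suc ρ ≤ ℓ → raise (suc ρ) u ℓ ≡ u ℓ
raise-from-return {u = u} {ρ} p ρ<L uρ≡0 (suc m) (s≤s ρ≤m) with m≤n⇒m<n∨m≡n ρ≤m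
... | inj₁ ρ<m  = raise-after u m ρ<m
... | inj₂ refl = trans (raise-before u ρ (n<1+n ρ)) (trans (cong suc uρ≡0) (sym (after-zero p ρ<L uρ≡0)))

raise-excursion : ∀ {L u ρ} → Path L u → 2 ≤ ρ → suc ρ < L → u ρ ≡ 0 →
  (∀ i → 1 ≤ i → i < ρ → u i ≢ 0) → FirstExcursion L (raise (suc ρ) u) (suc ρ)
raise-excursion {L} {u} {ρ} p 2≤ρ ρ+1<L uρ≡0 positive = record
  { path    = record { start = refl ; end = end′ ; step = step′ }
  ; r≥3     = s≤s 2≤ρ
  ; r<L     = ρ+1<L
  ; returns = trans (raise-before u ρ ≤-refl) (cong suc uρ≡0)
  ; above   = above′
  }
  where
  ρ<L : ρ < L
  ρ<L = <-trans (n<1+n ρ) ρ+1<L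
  from-return : ∀ ℓ → suc ρ ≤ ℓ → raise (suc ρ) u ℓ ≡ u ℓ
  from-return = raise-from-return p ρ<L uρ≡0
  end′ : ∀ k → L ≤ k → raise (suc ρ) u k ≡ 0
  end′ k L≤k = trans (from-return k (<⇒≤ (<-≤-trans ρ+1<L L≤k))) (end p k L≤k)
  step′ : ∀ k → k < L → Adj (raise (suc ρ) u (suc k)) (raise (suc ρ) u k)
  step′ zero _ =
    subst (λ x → Adj x 0) (sym (trans (raise-before {suc ρ} u 0 z<s) (cong suc (start p)))) (inj₁ refl)
  step′ (suc k) k+1<L with k <? ρ
  ... | yes k<ρ = subst₂ Adj (sym (raise-before u (suc k) (s≤s k<ρ))) (sym (raise-before u k (m<n⇒m<1+n k<ρ)))
                    (Adj-suc (step p k (<-trans (n<1+n k) k+1<L)))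
  ... | no  k≮ρ = subst₂ Adj (sym (from-return (suc (suc k)) (s≤s (m≤n⇒m≤1+n (≮⇒≥ k≮ρ)))))
                    (sym (from-return (suc k) (s≤s (≮⇒≥ k≮ρ)))) (step p (suc k) k+1<L)
  above′ : ∀ i → 2 ≤ i → i < suc ρ → 2 ≤ raise (suc ρ) u i
  above′ (suc i) (s≤s 1≤i) (s≤s i<ρ) =
    subst (2 ≤_) (sym (raise-before u i (m<n⇒m<1+n i<ρ))) (s≤s (n≢0⇒n>0 (positive i 1≤i i<ρ)))

lower-raise : ∀ {L u ρ} → Path L u → ρ < L → u ρ ≡ 0 → ∀ ℓ → lower (suc ρ) (raise (suc ρ) u) ℓ ≡ u ℓ
lower-raise {u = u} {ρ} p ρ<L uρ≡0 ℓ with ℓ <? suc ρ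
... | yes ℓ≤ρ = trans (lower-before (raise (suc ρ) u) ℓ ℓ≤ρ) (cong pred (raise-before u ℓ ℓ≤ρ))
... | no  ℓ≰ρ = trans (lower-after (raise (suc ρ) u) ℓ (≮⇒≥ ℓ≰ρ)) (raise-from-return p ρ<L uρ≡0 ℓ (≮⇒≥ ℓ≰ρ))

raise-zero : ∀ {ρ} u ℓ → 1 ≤ ℓ → raise (suc ρ) u ℓ ≡ 0 → ρ < ℓ × u ℓ ≡ 0
raise-zero {ρ} u (suc m) _ z with m <? suc ρ
... | yes m≤ρ = ⊥-elim (0≢1+n (trans (sym z) (raise-before u m m≤ρ)))
... | no  m≰ρ = m<n⇒m<1+n (≮⇒≥ m≰ρ) , trans (sym (raise-after u m (≮⇒≥ m≰ρ))) z

raise-lower : ∀ {L s r t} → FirstExcursion L s r → (∀ k → lower r s k ≡ t k) → ∀ ℓ → raise r t ℓ ≡ s ℓ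
raise-lower E _ zero = sym (start (path E))
raise-lower {s = s} {r} {t} E eq (suc ℓ) with ℓ <? r
... | yes ℓ<r = begin
  raise r t (suc ℓ)        ≡⟨ raise-before t ℓ ℓ<r ⟩
  suc (t ℓ)                ≡⟨ cong suc (sym (eq ℓ)) ⟩
  suc (lower r s ℓ)        ≡⟨ cong suc (lower-before s ℓ ℓ<r) ⟩
  suc (pred (s (suc ℓ)))   ≡⟨ suc-pred⁺ (excursion-positive E (suc ℓ) (s≤s z≤n) ℓ<r) ⟩
  s (suc ℓ)                ∎
... | no ℓ≮r = trans (raise-after t ℓ (≮⇒≥ ℓ≮r))
                   (trans (sym (eq (suc ℓ))) (lower-after s (suc ℓ) (m≤n⇒m≤1+n (≮⇒≥ ℓ≮r))))

lower-at-return : ∀ {L s r} → FirstExcursion L s r → ∀ ρ → suc ρ ≡ r → lower r s ρ ≡ 0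
lower-at-return {s = s} E ρ ρ+1≡r =
  trans (lower-before s ρ (≤-reflexive ρ+1≡r)) (cong pred (trans (cong s ρ+1≡r) (returns E)))

lower-positive : ∀ {L s r} → FirstExcursion L s r → ∀ ℓ → 1 ≤ ℓ → suc ℓ < r → lower r s ℓ ≢ 0
lower-positive {s = s} E ℓ 1≤ℓ ℓ+1<r z = m<n⇒n≢0 (pred-mono-≤ (above E (suc ℓ) (s≤s 1≤ℓ) ℓ+1<r))
  (trans (sym (lower-before s ℓ (<-trans (n<1+n ℓ) ℓ+1<r))) z)

lower-zero : ∀ {L s r} → FirstExcursion L s r → ∀ ℓ → 1 ≤ ℓ → lower r s ℓ ≡ 0 → suc ℓ ≡ r ⊎ s ℓ ≡ 0
lower-zero {s = s} {r} E ℓ 1≤ℓ z with <-cmp (suc ℓ) r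
... | tri< ℓ+1<r _ _ = ⊥-elim (lower-positive E ℓ 1≤ℓ ℓ+1<r z)
... | tri≈ _ ℓ+1≡r _ = inj₁ ℓ+1≡r
... | tri> _ _ r<ℓ+1 = inj₂ (trans (sym (lower-after s ℓ (≤-pred r<ℓ+1))) z)

-- The return time can be read off the lowered profile: an earlier return time would be a
-- zero of the other lowered profile inside its positive stretch.
earlier-return : ∀ {L s r L′ s′ r′} → FirstExcursion L s r → FirstExcursion L′ s′ r′ → r < r′ →
  ¬ (∀ ℓ → lower r s ℓ ≡ lower r′ s′ ℓ)
earlier-return {r = zero}  E _ _ _ with () ← r≥3 E
earlier-return {r = suc ρ} E E′ r<r′ eq =
  lower-positive E′ ρ (≤-trans (s≤s z≤n) (≤-pred (r≥3 E))) r<r′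
    (trans (sym (eq ρ)) (lower-at-return E ρ refl))

return-time-unique : ∀ {L s r L′ s′ r′} → FirstExcursion L s r → FirstExcursion L′ s′ r′ →
  (∀ ℓ → lower r s ℓ ≡ lower r′ s′ ℓ) → r ≡ r′
return-time-unique {r = r} {r′ = r′} E E′ eq with <-cmp r r′
... | tri< r<r′ _ _ = ⊥-elim (earlier-return E E′ r<r′ eq)
... | tri≈ _ r≡r′ _ = r≡r′
... | tri> _ _ r′<r = ⊥-elim (earlier-return E′ E r′<r (λ ℓ → sym (eq ℓ)))

Tval-late : ∀ n S ℓ → 2 ≤ ℓ → τ n S ≤ ℓ → Tval n S ℓ ≡ S ‼ ℓ
Tval-late n S ℓ@(suc (suc _)) _ τ≤ℓ rewrite dec-false (ℓ <? τ n S) (≤⇒≯ τ≤ℓ) = refl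
Tval-late n S (suc zero) (s≤s ()) _

Tval-window : ∀ n S ℓ → 2 ≤ ℓ → ℓ < τ n S →
  Tval n S ℓ ≡ (if does (S ‼ suc ℓ ℤ.≟ S ‼ ℓ - 1ℤ) then S ‼ ℓ - + 2 else S ‼ ℓ)
Tval-window n S ℓ@(suc (suc _)) _ ℓ<τ rewrite dec-true (ℓ <? τ n S) ℓ<τ = refl
Tval-window n S (suc zero) (s≤s ()) _

up≢down : ∀ a → + suc a ≢ + a - 1ℤ
up≢down zero    ()
up≢down (suc a) e = m≢1+n+m a (sym (ℤ.+-injective e))

-- Either way, the window rule yields S_{ℓ+1} − 1.
window-value : ∀ {x y : ℤ} a c → x ≡ + a → y ≡ + suc c → Adj (suc c) a →
  (if does (y ℤ.≟ x - 1ℤ) then x - + 2 else x) ≡ + c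
window-value a _ refl refl (inj₁ refl) rewrite dec-false (+ suc a ℤ.≟ + a - 1ℤ) (up≢down a) = refl
window-value _ c refl refl (inj₂ refl) rewrite dec-true (+ suc c ℤ.≟ + suc (suc c) - 1ℤ) refl = refl

Tval-lower : ∀ {n} {S : Seq n} {s} → HasHeights S s → FirstExcursion (2 * n) s (τ n S) →
  ∀ ℓ → Tval n S ℓ ≡ + lower (τ n S) s ℓ
Tval-lower {s = s} hS E zero =
  cong +_ (sym (trans (lower-before s 0 (0<r E)) (cong pred (excursion-1 E))))
Tval-lower {s = s} hS E (suc zero) =
  height⇒value hS (trans (excursion-1 E) (sym (trans (lower-before s 1 (1<r E)) (cong pred (excursion-2 E)))))
Tval-lower {n} {S} {s} hS E ℓ@(suc (suc _)) with ℓ <? τ n S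
... | yes ℓ<τ = trans (Tval-window n S ℓ (s≤s (s≤s z≤n)) ℓ<τ) (trans
      (window-value (s ℓ) (pred (s (suc ℓ))) (entry hS ℓ) (height⇒value hS next)
        (subst (λ x → Adj x (s ℓ)) next (step (path E) ℓ (<-trans ℓ<τ (r<L E)))))
      (cong +_ (sym (lower-before s ℓ ℓ<τ))))
  where
  next : s (suc ℓ) ≡ suc (pred (s (suc ℓ)))
  next = sym (suc-pred⁺ (excursion-positive E (suc ℓ) (s≤s z≤n) ℓ<τ))
... | no  ℓ≮τ = trans (Tval-late n S ℓ (s≤s (s≤s z≤n)) (≮⇒≥ ℓ≮τ))
                      (height⇒value hS (sym (lower-after s ℓ (≮⇒≥ ℓ≮τ))))

Φ₂-heights : ∀ {n} {S : Seq n} {s} → HasHeights S s → FirstExcursion (2 * n) s (τ n S) →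
  HasHeights (Φ₂ n S) (lower (τ n S) s)
Φ₂-heights {n} {S} {s} hS E = hasHeights entry′
  where
  entry′ : ∀ ℓ → Φ₂ n S ‼ ℓ ≡ + lower (τ n S) s ℓ
  entry′ ℓ with ℓ ≤? 2 * n
  ... | yes ℓ≤2n = trans (‼-tabulate (Tval n S) ℓ (s≤s ℓ≤2n)) (Tval-lower hS E ℓ)
  ... | no  ℓ≰2n = trans (‼-beyond (Φ₂ n S) ℓ 2n<ℓ)
        (cong +_ (sym (trans (lower-after s ℓ (<⇒≤ (<-trans (r<L E) 2n<ℓ))) (end (path E) ℓ (<⇒≤ 2n<ℓ)))))
    where
    2n<ℓ : 2 * n < ℓ
    2n<ℓ = ≰⇒> ℓ≰2n

excursion-τ : ∀ {n} {S : Seq n} {s r} → HasHeights S s → FirstExcursion (2 * n) s r → τ n S ≡ r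
excursion-τ {n} {S} {s} {r} hS E =
  findFrom-exact S 2 (2 * n ∸ 1) r hit (<-≤-trans (r<L E) (≤-trans (m≤n+m∸n (2 * n) 1) (n≤1+n _)))
  where
  hit : FirstOne S 2 r
  hit = record
    { from  = ≤-trans (n≤1+n 2) (r≥3 E)
    ; hits  = height⇒value hS (returns E)
    ; first = λ i 2≤i i<r e → <-irrefl refl (subst (2 ≤_) (value⇒height hS e) (above E i 2≤i i<r))
    }

𝒞⇒FirstExcursion : ∀ {n} {S : Seq n} → 2 ≤ n → 𝒞 n S → FirstExcursion (2 * n) (height S) (τ n S)
𝒞⇒FirstExcursion {n} {S} 2≤n (inT , c) = record
  { path = p ; r≥3 = τ≥3 ; r<L = proj₂ found ; returns = value⇒height hS (hits hit) ; above = above′ }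
  where
  s  = height S
  hS = InT⇒HasHeights {n} {S} inT
  p  = InT⇒Path {n} {S} inT
  found = τ-first-one {n} 2≤n hS p
  hit = proj₁ found
  4≤2n : 4 ≤ 2 * n
  4≤2n = *-monoʳ-≤ 2 2≤n
  not-one : ∀ i → 2 ≤ i → i < τ n S → s i ≢ 1
  not-one i 2≤i i<τ e = first hit i 2≤i i<τ (height⇒value hS e)
  s₁ : s 1 ≡ 1
  s₁ = after-zero p (≤-trans (s≤s z≤n) 4≤2n) (start p)
  -- the path does not return to 0 at time 2, since S ∈ 𝒞ₙ
  s₂ : s 2 ≡ 2
  s₂ with step p 1 (≤-trans (s≤s (s≤s z≤n)) 4≤2n)
  ... | inj₁ e = trans e (cong suc s₁)
  ... | inj₂ e = ⊥-elim (countN≡0⇒ {n} hS c 1 ≤-refl 2≤n (suc-injective (trans (sym e) s₁)))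
  τ≥3 : 3 ≤ τ n S
  τ≥3 with m≤n⇒m<n∨m≡n (from hit)
  ... | inj₁ 2<τ = 2<τ
  ... | inj₂ 2≡τ with () ← trans (sym s₂) (trans (cong s 2≡τ) (value⇒height hS (hits hit)))
  -- reaching 0 before τ would require visiting 1 first
  nonzero : ∀ i → 2 ≤ i → i < τ n S → s i ≢ 0
  nonzero i 2≤i i<τ z with m≤n⇒m<n∨m≡n 2≤i
  ... | inj₂ refl = 0≢1+n (trans (sym z) s₂)
  nonzero (suc i) _ i+1<τ z | inj₁ (s≤s 2≤i) =
    not-one i 2≤i i<τ (before-zero p (<-trans i<τ (proj₂ found)) z)
    where
    i<τ : i < τ n S
    i<τ = <-trans (n<1+n i) i+1<τ
  above′ : ∀ i → 2 ≤ i → i < τ n S → 2 ≤ s i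
  above′ i 2≤i i<τ = two≤ (nonzero i 2≤i i<τ) (not-one i 2≤i i<τ)

-- Lowering an excursion without even zeros in (0, 2n) leaves exactly one, at r − 1
-- (r is odd, being a visit to 1).
lower-unique-even-zero : ∀ {n s r} → FirstExcursion (2 * n) s r → NoEvenZero n s →
  ∃ (UniqueEvenZero n (lower r s))
lower-unique-even-zero {n} {s} {r} E none with one-at-odd (path E) r (<⇒≤ (r<L E)) (returns E)
... | j , r≡2j+1 = j , 1≤j , j<n , lower-at-return E (2 * j) (sym r≡2j+1) , only
  where
  1≤j : 1 ≤ j
  1≤j = *-cancelˡ-≤ 2 (≤-pred (subst (3 ≤_) r≡2j+1 (r≥3 E)))
  j<n : j < n
  j<n = *-cancelˡ-< 2 j n (<-trans (n<1+n (2 * j)) (subst (_< 2 * n) r≡2j+1 (r<L E)))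
  only : ∀ i → 1 ≤ i → i < n → lower r s (2 * i) ≡ 0 → i ≡ j
  only i 1≤i i<n z with lower-zero E (2 * i) (≤-trans 1≤i (m≤n*m i 2)) z
  ... | inj₁ 2i+1≡r = *-cancelˡ-≡ i j 2 (suc-injective (trans 2i+1≡r r≡2j+1))
  ... | inj₂ s≡0    = ⊥-elim (none i 1≤i i<n s≡0)

-- On a path, a unique even zero in (0, 2n) is its only zero there, as zeros occur at even times.
only-interior-zero : ∀ {n u j} → Path (2 * n) u → UniqueEvenZero n u j →
  ∀ k → 1 ≤ k → k < 2 * n → u k ≡ 0 → k ≡ 2 * j
only-interior-zero {n} {u} p (_ , _ , _ , only) k 1≤k k<2n z with zero-at-even p k (<⇒≤ k<2n) z
... | i , k≡2i = trans k≡2i (cong (2 *_) (only i (half-positive 1≤k k≡2i)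
      (*-cancelˡ-< 2 i n (subst (_< 2 * n) k≡2i k<2n)) (subst (λ x → u x ≡ 0) k≡2i z)))
  where
  half-positive : ∀ {k i} → 1 ≤ k → k ≡ 2 * i → 1 ≤ i
  half-positive {i = zero}  (s≤s _) ()
  half-positive {i = suc _} _       _ = s≤s z≤n

Φ₂-maps-𝒞-to-𝒟 : ∀ {n} {S : Seq n} → 2 ≤ n → 𝒞 n S → 𝒟 n (Φ₂ n S)
Φ₂-maps-𝒞-to-𝒟 {n} {S} 2≤n C@(inT , c) =
    HasHeights⇒InT {n} hT (lower-path E)
  , ⇒countN≡1 {n} hT (proj₂ (lower-unique-even-zero E (countN≡0⇒ {n} hS c)))
  where
  hS = InT⇒HasHeights {n} {S} inT
  E  = 𝒞⇒FirstExcursion {n} 2≤n C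
  hT = Φ₂-heights {n} hS E

-- Φ₂ is injective on 𝒞ₙ: equal images have the same lowered profile, hence the same
-- return time, hence (raising back) the same heights.
Φ₂-injective : ∀ {n} {S S′ : Seq n} → 2 ≤ n → 𝒞 n S → 𝒞 n S′ → Φ₂ n S ≡ Φ₂ n S′ → S ≡ S′
Φ₂-injective {n} {S} {S′} 2≤n C C′ eq =
  ‼-ext S S′ (λ ℓ → trans (height⇒value hS (same-heights ℓ)) (sym (entry hS′ ℓ)))
  where
  hS  = InT⇒HasHeights {n} {S} (proj₁ C)
  hS′ = InT⇒HasHeights {n} {S′} (proj₁ C′)
  E   = 𝒞⇒FirstExcursion {n} 2≤n C
  E′  = 𝒞⇒FirstExcursion {n} 2≤n C′
  same-lowered : ∀ ℓ → lower (τ n S) (height S) ℓ ≡ lower (τ n S′) (height S′) ℓ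
  same-lowered ℓ =
    value⇒height (Φ₂-heights {n} hS E) (trans (cong (_‼ ℓ) eq) (entry (Φ₂-heights {n} hS′ E′) ℓ))
  same-τ : τ n S ≡ τ n S′
  same-τ = return-time-unique E E′ same-lowered
  t : ℕ → ℕ
  t = lower (τ n S) (height S)
  same-heights : ∀ ℓ → height S ℓ ≡ height S′ ℓ
  same-heights ℓ = begin
    height S ℓ          ≡⟨ raise-lower E (λ _ → refl) ℓ ⟨
    raise (τ n S) t ℓ   ≡⟨ cong (λ r → raise r t ℓ) same-τ ⟩
    raise (τ n S′) t ℓ  ≡⟨ raise-lower E′ (λ k → sym (same-lowered k)) ℓ ⟩
    height S′ ℓ         ∎

-- Φ₂ maps 𝒞ₙ onto 𝒟ₙ: for U ∈ 𝒟ₙ with its unique interior zero at ρ, raising U at ρ + 1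
-- gives a preimage.
Φ₂-onto-𝒟 : ∀ {n} {U : Seq n} → 2 ≤ n → 𝒟 n U → Σ (Seq n) (λ S → 𝒞 n S × Φ₂ n S ≡ U)
Φ₂-onto-𝒟 {n} {U} 2≤n (inT , c) with countN≡1⇒ {n} (InT⇒HasHeights {n} {U} inT) c
... | j , unique@(1≤j , j<n , uρ≡0 , _) =
  S , (HasHeights⇒InT {n} hS (path E) , ⇒countN≡0 {n} hS no-even-zero) , ‼-ext (Φ₂ n S) U same-entries
  where
  u  = height U
  hU = InT⇒HasHeights {n} {U} inT
  pU = InT⇒Path {n} {U} inT
  ρ  = 2 * j
  ρ+1<2n : suc ρ < 2 * n
  ρ+1<2n = subst (_≤ 2 * n) (*-suc 2 j) (*-monoʳ-≤ 2 j<n)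
  ρ<2n : ρ < 2 * n
  ρ<2n = <-trans (n<1+n ρ) ρ+1<2n
  zero⇒ρ : ∀ k → 1 ≤ k → k < 2 * n → u k ≡ 0 → k ≡ ρ
  zero⇒ρ = only-interior-zero pU unique
  E : FirstExcursion (2 * n) (raise (suc ρ) u) (suc ρ)
  E = raise-excursion pU (*-monoʳ-≤ 2 1≤j) ρ+1<2n uρ≡0
        (λ i 1≤i i<ρ z → <-irrefl (zero⇒ρ i 1≤i (<-trans i<ρ ρ<2n) z) i<ρ)
  S = fromHeights n (raise (suc ρ) u)
  hS : HasHeights S (raise (suc ρ) u)
  hS = fromHeights-heights {n} (path E)
  τ≡ρ+1 : τ n S ≡ suc ρ
  τ≡ρ+1 = excursion-τ {n} hS E
  no-even-zero : NoEvenZero n (raise (suc ρ) u)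
  no-even-zero i 1≤i i<n z with raise-zero u (2 * i) (≤-trans 1≤i (m≤n*m i 2)) z
  ... | ρ<2i , u≡0 = <-irrefl (sym (zero⇒ρ (2 * i) (≤-trans 1≤i (m≤n*m i 2)) (*-monoʳ-< 2 i<n) u≡0)) ρ<2i
  E-at-τ : FirstExcursion (2 * n) (raise (suc ρ) u) (τ n S)
  E-at-τ = subst (FirstExcursion (2 * n) _) (sym τ≡ρ+1) E
  same-entries : ∀ ℓ → Φ₂ n S ‼ ℓ ≡ U ‼ ℓ
  same-entries ℓ = begin
    Φ₂ n S ‼ ℓ                              ≡⟨ entry (Φ₂-heights {n} hS E-at-τ) ℓ ⟩
    + lower (τ n S) (raise (suc ρ) u) ℓ     ≡⟨ cong (λ r → + lower r (raise (suc ρ) u) ℓ) τ≡ρ+1 ⟩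
    + lower (suc ρ) (raise (suc ρ) u) ℓ     ≡⟨ cong +_ (lower-raise pU ρ<2n uρ≡0 ℓ) ⟩
    + u ℓ                                   ≡⟨ entry hU ℓ ⟨
    U ‼ ℓ                                   ∎

theorem2 : (n : ℕ) → 2 ≤ n →
    ((S : Seq n) → 𝒞 n S → 𝒟 n (Φ₂ n S))
    × ((S S′ : Seq n) → 𝒞 n S → 𝒞 n S′ → Φ₂ n S ≡ Φ₂ n S′ → S ≡ S′)
    × ((U : Seq n) → 𝒟 n U → Σ (Seq n) (λ S → 𝒞 n S × Φ₂ n S ≡ U))
theorem2 n 2≤n =
    (λ S C → Φ₂-maps-𝒞-to-𝒟 {S = S} 2≤n C)
  , (λ S S′ C C′ → Φ₂-injective {S = S} {S′} 2≤n C C′)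
  , (λ U D → Φ₂-onto-𝒟 {U = U} 2≤n D)
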